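{- Let $G$ be an $n$-vertex oriented $d$-regular graph with $d$ odd, let $V^+$ be the set of vertices $v$ with $d^+(v)>d^-(v)$ and $V^-$ the set of vertices $v$ with $d^+(v)<d^-(v)$. Then the number of arcs with tail in $V^+$ and head in $V^-$ is at least $$\max\left\{\frac{n}{2},\ \frac{2}{d+1/d}\cdot \mathrm{maxdicut}(G)\right\}.$$
   Context: An oriented graph is $d$-regular if its underlying undirected graph is $d$-regular (out-degrees arbitrary). $d^+(v)$ and $d^-(v)$ denote out-degree and in-degree of $v$; since $d$ is odd, $(V^+,V^-)$ is a bipartition of the vertex set. For a bipartition $(V_1,V_2)$ of the vertex set, the directed cut $\overrightarrow{E}(V_1,V_2)$ is the set of arcs with tail in $V_1$ and head in $V_2$; $\mathrm{maxdicut}(G)$ is the maximum of $|\overrightarrow{E}(V_1,V_2)|$ over all bipartitions. -}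

module Defs where

open import Data.Nat using (ℕ; zero; suc; _+_; _*_; _⊔_; _<ᵇ_)
open import Data.Bool using (Bool; true; false; _∧_; _∨_; not; if_then_else_)
open import Data.Fin using (Fin; zero; suc)
open import Data.List using (List; []; _∷_; map; _++_; foldr)
open import Data.Product using (∃; _×_)
open import Relation.Binary.PropositionalEquality using (_≡_)
open import Data.Empty using (⊥)

count : ∀ {n} → (Fin n → Bool) → ℕ
count {zero}  f = 0
count {suc n} f = (if f zero then 1 else 0) + count (λ i → f (suc i))

-- A digraph on vertex set Fin n, given by its arc relation: arc u v = true iff u → v
Digraph : ℕ → Set
Digraph n = Fin n → Fin n → Bool

-- oriented graph: no loops, no pair of opposite arcs (no multi-arcs by construction)
IsOriented : ∀ {n} → Digraph n → Set
IsOriented {n} A =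
  ((v : Fin n) → A v v ≡ false) ×
  ((u v : Fin n) → A u v ≡ true → A v u ≡ false)

outdeg : ∀ {n} → Digraph n → Fin n → ℕ
outdeg A v = count (λ u → A v u)

indeg : ∀ {n} → Digraph n → Fin n → ℕ
indeg A v = count (λ u → A u v)

undeg : ∀ {n} → Digraph n → Fin n → ℕ
undeg A v = count (λ u → A u v ∨ A v u)

IsRegular : ∀ {n} → Digraph n → ℕ → Set
IsRegular {n} A d = (v : Fin n) → undeg A v ≡ d

Odd : ℕ → Set
Odd d = ∃ λ k → d ≡ suc (2 * k)

inV⁺ : ∀ {n} → Digraph n → Fin n → Bool
inV⁺ A v = indeg A v <ᵇ outdeg A v

inV⁻ : ∀ {n} → Digraph n → Fin n → Bool
inV⁻ A v = outdeg A v <ᵇ indeg A v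

sumF : ∀ {n} → (Fin n → ℕ) → ℕ
sumF {zero}  f = 0
sumF {suc n} f = f zero + sumF (λ i → f (suc i))

arcsBetween : ∀ {n} → Digraph n → (Fin n → Bool) → (Fin n → Bool) → ℕ
arcsBetween A P Q = sumF (λ u → count (λ v → P u ∧ Q v ∧ A u v))

-- all bipartitions (V₁ = {v | S v = true}, V₂ its complement) of Fin n
allSubsets : (n : ℕ) → List (Fin n → Bool)
allSubsets zero    = (λ ()) ∷ []
allSubsets (suc n) =
  map (λ S → λ { zero → true  ; (suc i) → S i }) (allSubsets n) ++
  map (λ S → λ { zero → false ; (suc i) → S i }) (allSubsets n)

dicut : ∀ {n} → Digraph n → (Fin n → Bool) → ℕ
dicut A S = arcsBetween A S (λ v → not (S v))

maxdicut : ∀ {n} → Digraph n → ℕ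
maxdicut {n} A = foldr _⊔_ 0 (map (dicut A) (allSubsets n))

-- Both bounds are discharging arguments. Each arc end at a vertex w earns a
-- charge on the majority side of w (its out-ends if w ∈ V⁺, its in-ends if
-- w ∈ V⁻) and pays one on its minority side. If every vertex keeps a nonnegative
-- balance and every arc u → v satisfies a local inequality weighing it against
-- the arcs of E→(V⁺,V⁻), summing over all arcs bounds the arcs of interest by
-- e = |E→(V⁺,V⁻)|. For n ≤ 2e all charges are 1 and every vertex keeps a surplus
-- of at least 1. For the dicut of a set S write d = 2k + 1 and let r w be k if
-- "w ∈ S" and "w ∈ V⁺" agree and k + 1 otherwise; an end earns k·r w and pays
-- (k + 1)·r w. Vertices stay nonnegative because the minority degree is at most
-- k and the majority degree at least k + 1, and the arc inequalities, tight on
-- cut arcs, give d·dicut S ≤ (k² + (k + 1)²)·e, where 2(k² + (k + 1)²) = d² + 1.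
module Submission where

open import Defs
open import Data.Nat using (ℕ; zero; suc; _+_; _*_; _≤_; _<_; _<ᵇ_; _⊔_; z≤n; s≤s⁻¹)
open import Data.Nat.Properties
open import Data.Nat.Tactic.RingSolver using (solve; solve-∀)
open import Algebra.Properties.Semiring.Sum +-*-semiring
  using (sum; sum-cong-≗; ∑-distrib-+; ∑-comm; *-distribˡ-sum; *-distribʳ-sum)
open import Data.Bool using (Bool; true; false; not; _∧_; _∨_; _xor_; if_then_else_)
open import Data.Bool.Properties using (T-≡)
open import Data.Fin using (Fin)
open import Data.List using ([]; _∷_)
open import Data.List.Properties using (foldr-preservesᵇ)
open import Data.List.Relation.Unary.All using (universal)
open import Data.List.Relation.Unary.All.Properties using (map⁺)
open import Data.Product using (_×_; _,_)
open import Data.Sum using (_⊎_; inj₁; inj₂)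
open import Function using (_∘_; Equivalence)
open import Relation.Binary.Definitions using (tri<; tri≈; tri>)
open import Relation.Binary.PropositionalEquality
open import Relation.Nullary using (contradiction)

ind : Bool → ℕ
ind b = if b then 1 else 0

ind-∧ : ∀ x y → ind (x ∧ y) ≡ ind x * ind y
ind-∧ true  y = sym (+-identityʳ (ind y))
ind-∧ false y = refl

ind-∨ : ∀ x y → (x ≡ true → y ≡ false) → ind (x ∨ y) ≡ ind x + ind y
ind-∨ true  true  disjoint = contradiction (disjoint refl) (λ ())
ind-∨ true  false _        = refl
ind-∨ false y     _        = refl

ind-*-mono-≤ : ∀ b {m n} → (b ≡ true → m ≤ n) → ind b * m ≤ ind b * n
ind-*-mono-≤ true  m≤n = +-monoˡ-≤ 0 (m≤n refl)
ind-*-mono-≤ false _   = z≤n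

≤-slack : ∀ {m n} s → m + s ≡ n → m ≤ n
≤-slack {m} s refl = m≤m+n m s

<ᵇ-true : ∀ {m n} → m < n → (m <ᵇ n) ≡ true
<ᵇ-true m<n = Equivalence.to T-≡ (<⇒<ᵇ m<n)

<ᵇ-false : ∀ {m n} → n ≤ m → (m <ᵇ n) ≡ false
<ᵇ-false {m} {n} n≤m with m <ᵇ n in m<ᵇn
... | false = refl
... | true  = contradiction (<ᵇ⇒< m n (Equivalence.from T-≡ m<ᵇn)) (≤⇒≯ n≤m)

sumF≡sum : ∀ {n} (f : Fin n → ℕ) → sumF f ≡ sum f
sumF≡sum {zero}  f = refl
sumF≡sum {suc n} f = cong (f Fin.zero +_) (sumF≡sum (f ∘ Fin.suc))

count≡sum : ∀ {n} (P : Fin n → Bool) → count P ≡ sum (ind ∘ P)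
count≡sum {zero}  P = refl
count≡sum {suc n} P = cong (ind (P Fin.zero) +_) (count≡sum (P ∘ Fin.suc))

sum-mono-≤ : ∀ {n} {f g : Fin n → ℕ} → (∀ i → f i ≤ g i) → sum f ≤ sum g
sum-mono-≤ {zero}  _   = z≤n
sum-mono-≤ {suc n} f≤g = +-mono-≤ (f≤g Fin.zero) (sum-mono-≤ (f≤g ∘ Fin.suc))

sum-const : ∀ n c → sum {n} (λ _ → c) ≡ n * c
sum-const zero    c = refl
sum-const (suc n) c = cong (c +_) (sum-const n c)

∑-split : ∀ {n} {f g h : Fin n → ℕ} → (∀ i → f i ≡ g i + h i) → sum f ≡ sum g + sum h
∑-split {g = g} {h} f≗g+h = trans (sum-cong-≗ f≗g+h) (∑-distrib-+ g h)

arcsBetween≡∑ : ∀ {n} (A : Digraph n) (P Q : Fin n → Bool) →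
  arcsBetween A P Q ≡ sum (λ u → sum (λ v → ind (P u ∧ Q v ∧ A u v)))
arcsBetween≡∑ A P Q =
  trans (sumF≡sum (λ u → count (λ v → P u ∧ Q v ∧ A u v)))
        (sum-cong-≗ (λ u → count≡sum (λ v → P u ∧ Q v ∧ A u v)))

arcsBetween-congʳ : ∀ {n} (A : Digraph n) (P : Fin n → Bool) {Q R : Fin n → Bool} →
  (∀ v → Q v ≡ R v) → arcsBetween A P Q ≡ arcsBetween A P R
arcsBetween-congʳ A P {Q} {R} Q≗R = begin
  arcsBetween A P Q
    ≡⟨ arcsBetween≡∑ A P Q ⟩
  sum (λ u → sum (λ v → ind (P u ∧ Q v ∧ A u v)))
    ≡⟨ sum-cong-≗ (λ u → sum-cong-≗ (λ v → cong (λ q → ind (P u ∧ q ∧ A u v)) (Q≗R v))) ⟩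
  sum (λ u → sum (λ v → ind (P u ∧ R v ∧ A u v)))
    ≡⟨ arcsBetween≡∑ A P R ⟨
  arcsBetween A P R
    ∎
  where open ≡-Reasoning

outdeg+indeg≡undeg : ∀ {n} (A : Digraph n) → IsOriented A →
  ∀ w → outdeg A w + indeg A w ≡ undeg A w
outdeg+indeg≡undeg A (_ , antisymmetric) w = begin
  outdeg A w + indeg A w
    ≡⟨ +-comm (outdeg A w) (indeg A w) ⟩
  indeg A w + outdeg A w
    ≡⟨ cong₂ _+_ (count≡sum (λ u → A u w)) (count≡sum (A w)) ⟩
  sum (λ u → ind (A u w)) + sum (λ u → ind (A w u))
    ≡⟨ ∑-split (λ u → ind-∨ (A u w) (A w u) (antisymmetric u w)) ⟨
  sum (λ u → ind (A u w ∨ A w u))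
    ≡⟨ count≡sum (λ u → A u w ∨ A w u) ⟨
  undeg A w
    ∎
  where open ≡-Reasoning

∑-tail-head : ∀ {n} (A : Digraph n) (t h : Fin n → ℕ) →
  sum (λ u → sum (λ v → ind (A u v) * (t u + h v)))
    ≡ sum (λ w → outdeg A w * t w + indeg A w * h w)
∑-tail-head A t h = begin
  sum (λ u → sum (λ v → ind (A u v) * (t u + h v)))
    ≡⟨ ∑-split (λ u → ∑-split (λ v → *-distribˡ-+ (ind (A u v)) (t u) (h v))) ⟩
  sum (λ u → sum (λ v → ind (A u v) * t u)) + sum (λ u → sum (λ v → ind (A u v) * h v))
    ≡⟨ cong₂ _+_ (sum-cong-≗ at-tail)
                 (trans (∑-comm (λ u v → ind (A u v) * h v)) (sum-cong-≗ at-head)) ⟩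
  sum (λ w → outdeg A w * t w) + sum (λ w → indeg A w * h w)
    ≡⟨ ∑-distrib-+ (λ w → outdeg A w * t w) (λ w → indeg A w * h w) ⟨
  sum (λ w → outdeg A w * t w + indeg A w * h w)
    ∎
  where
  open ≡-Reasoning
  at-tail : ∀ u → sum (λ v → ind (A u v) * t u) ≡ outdeg A u * t u
  at-tail u = sym (trans (cong (_* t u) (count≡sum (A u)))
                         (*-distribʳ-sum (t u) (λ v → ind (A u v))))
  at-head : ∀ v → sum (λ u → ind (A u v) * h v) ≡ indeg A v * h v
  at-head v = sym (trans (cong (_* h v) (count≡sum (λ u → A u v)))
                         (*-distribʳ-sum (h v) (λ u → ind (A u v))))

∑-arc-indicator : ∀ {n} (A : Digraph n) (P Q : Fin n → Bool) a →
  sum (λ u → sum (λ v → ind (A u v) * (ind (P u ∧ Q v) * a))) ≡ a * arcsBetween A P Q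
∑-arc-indicator A P Q a = begin
  sum (λ u → sum (λ v → ind (A u v) * (ind (P u ∧ Q v) * a)))
    ≡⟨ sum-cong-≗ (λ u → sum-cong-≗ (λ v → weight (P u) (Q v) (A u v))) ⟩
  sum (λ u → sum (λ v → a * ind (P u ∧ Q v ∧ A u v)))
    ≡⟨ sum-cong-≗ (λ u → *-distribˡ-sum a (λ v → ind (P u ∧ Q v ∧ A u v))) ⟨
  sum (λ u → a * sum (λ v → ind (P u ∧ Q v ∧ A u v)))
    ≡⟨ *-distribˡ-sum a (λ u → sum (λ v → ind (P u ∧ Q v ∧ A u v))) ⟨
  a * sum (λ u → sum (λ v → ind (P u ∧ Q v ∧ A u v)))
    ≡⟨ cong (a *_) (arcsBetween≡∑ A P Q) ⟨
  a * arcsBetween A P Q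
    ∎
  where
  open ≡-Reasoning
  reorder : ∀ x y z a → z * (x * y * a) ≡ a * (x * (y * z))
  reorder = solve-∀
  weight : ∀ x y z → ind z * (ind (x ∧ y) * a) ≡ a * ind (x ∧ y ∧ z)
  weight x y z = begin
    ind z * (ind (x ∧ y) * a)      ≡⟨ cong (λ i → ind z * (i * a)) (ind-∧ x y) ⟩
    ind z * (ind x * ind y * a)    ≡⟨ reorder (ind x) (ind y) (ind z) a ⟩
    a * (ind x * (ind y * ind z))  ≡⟨ cong (λ i → a * (ind x * i)) (ind-∧ y z) ⟨
    a * (ind x * ind (y ∧ z))      ≡⟨ cong (a *_) (ind-∧ x (y ∧ z)) ⟨
    a * ind (x ∧ y ∧ z)            ∎

∑-arc-charges : ∀ {n} (A : Digraph n) (P Q : Fin n → Bool) a (t h : Fin n → ℕ) →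
  sum (λ u → sum (λ v → ind (A u v) * (ind (P u ∧ Q v) * a + (t u + h v))))
    ≡ a * arcsBetween A P Q + sum (λ w → outdeg A w * t w + indeg A w * h w)
∑-arc-charges A P Q a t h = begin
  sum (λ u → sum (λ v → ind (A u v) * (ind (P u ∧ Q v) * a + (t u + h v))))
    ≡⟨ ∑-split (λ u → ∑-split (λ v →
         *-distribˡ-+ (ind (A u v)) (ind (P u ∧ Q v) * a) (t u + h v))) ⟩
  sum (λ u → sum (λ v → ind (A u v) * (ind (P u ∧ Q v) * a)))
    + sum (λ u → sum (λ v → ind (A u v) * (t u + h v)))
    ≡⟨ cong₂ _+_ (∑-arc-indicator A P Q a) (∑-tail-head A t h) ⟩
  a * arcsBetween A P Q + sum (λ w → outdeg A w * t w + indeg A w * h w)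
    ∎
  where open ≡-Reasoning

discharge : ∀ {n} (A : Digraph n) (out⁺ in⁺ out⁻ in⁻ : Fin n → ℕ)
  (c a : ℕ) (P Q : Fin n → Bool) (b : ℕ) (P′ Q′ : Fin n → Bool) →
  (∀ u v → A u v ≡ true →
     ind (P u ∧ Q v) * a + (out⁺ u + in⁺ v) ≤ ind (P′ u ∧ Q′ v) * b + (out⁻ u + in⁻ v)) →
  (∀ w → c + (outdeg A w * out⁻ w + indeg A w * in⁻ w)
           ≤ outdeg A w * out⁺ w + indeg A w * in⁺ w) →
  n * c + a * arcsBetween A P Q ≤ b * arcsBetween A P′ Q′
discharge {n} A out⁺ in⁺ out⁻ in⁻ c a P Q b P′ Q′ arc vertex =
  +-cancelʳ-≤ paid _ _ (begin
    n * c + a * X + paid    ≡⟨ cong (_+ paid) (+-comm (n * c) (a * X)) ⟩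
    a * X + n * c + paid    ≡⟨ +-assoc (a * X) (n * c) paid ⟩
    a * X + (n * c + paid)  ≤⟨ +-monoʳ-≤ (a * X) vertices ⟩
    a * X + earned          ≤⟨ arcs ⟩
    b * Y + paid            ∎)
  where
  open ≤-Reasoning
  X Y earned paid : ℕ
  X = arcsBetween A P Q
  Y = arcsBetween A P′ Q′
  earned = sum (λ w → outdeg A w * out⁺ w + indeg A w * in⁺ w)
  paid   = sum (λ w → outdeg A w * out⁻ w + indeg A w * in⁻ w)
  vertices : n * c + paid ≤ earned
  vertices = subst (_≤ earned)
    (trans (∑-distrib-+ (λ _ → c) (λ w → outdeg A w * out⁻ w + indeg A w * in⁻ w))
           (cong (_+ paid) (sum-const n c)))
    (sum-mono-≤ vertex)
  arcs : a * X + earned ≤ b * Y + paid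
  arcs = subst₂ _≤_ (∑-arc-charges A P Q a out⁺ in⁺) (∑-arc-charges A P′ Q′ b out⁻ in⁻)
                    (sum-mono-≤ (λ u → sum-mono-≤ (λ v → ind-*-mono-≤ (A u v) (arc u v))))

majority-charge : ∀ σ {o i c g l} →
  c + (if σ then i else o) * l ≤ (if σ then o else i) * g →
  c + (o * (ind (not σ) * l) + i * (ind σ * l)) ≤ o * (ind σ * g) + i * (ind (not σ) * g)
majority-charge true {o} {i} {c} {g} {l} =
  subst₂ _≤_ (sym (minority c o i l)) (sym (majority o i g))
  where
  minority : ∀ c o i l → c + (o * (ind false * l) + i * (ind true * l)) ≡ c + i * l
  minority = solve-∀
  majority : ∀ o i g → o * (ind true * g) + i * (ind false * g) ≡ o * g
  majority = solve-∀
majority-charge false {o} {i} {c} {g} {l} =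
  subst₂ _≤_ (sym (minority c o i l)) (sym (majority o i g))
  where
  minority : ∀ c o i l → c + (o * (ind true * l) + i * (ind false * l)) ≡ c + o * l
  minority = solve-∀
  majority : ∀ o i g → o * (ind false * g) + i * (ind true * g) ≡ i * g
  majority = solve-∀

-- σ w says that the out-ends form the majority side of w.
majority-discharge : ∀ {n} (A : Digraph n) (σ : Fin n → Bool) (gain loss : Fin n → ℕ)
  (c a : ℕ) (P Q : Fin n → Bool) (b : ℕ) (P′ Q′ : Fin n → Bool) →
  (∀ u v → A u v ≡ true →
     ind (P u ∧ Q v) * a + (ind (σ u) * gain u + ind (not (σ v)) * gain v)
       ≤ ind (P′ u ∧ Q′ v) * b + (ind (not (σ u)) * loss u + ind (σ v) * loss v)) →
  (∀ w → c + (if σ w then indeg A w else outdeg A w) * loss w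
           ≤ (if σ w then outdeg A w else indeg A w) * gain w) →
  n * c + a * arcsBetween A P Q ≤ b * arcsBetween A P′ Q′
majority-discharge A σ gain loss c a P Q b P′ Q′ arc vertex =
  discharge A (λ w → ind (σ w) * gain w) (λ w → ind (not (σ w)) * gain w)
              (λ w → ind (not (σ w)) * loss w) (λ w → ind (σ w) * loss w)
              c a P Q b P′ Q′ arc (λ w → majority-charge (σ w) (vertex w))

maxdicut-lub : ∀ {n} (A : Digraph n) {c m : ℕ} → (∀ S → c * dicut A S ≤ m) → c * maxdicut A ≤ m
maxdicut-lub {n} A {c} {m} bound =
  foldr-preservesᵇ {P = λ x → c * x ≤ m} lub (subst (_≤ m) (sym (*-zeroʳ c)) z≤n)
                   (map⁺ (universal bound (allSubsets n)))
  where
  lub : ∀ {x y} → c * x ≤ m → c * y ≤ m → c * (x ⊔ y) ≤ m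
  lub {x} {y} cx≤m cy≤m = subst (_≤ m) (sym (*-distribˡ-⊔ c x y)) (⊔-lub cx≤m cy≤m)

minority-bound : ∀ {m M k} → m < M → m + M ≡ suc (2 * k) → m ≤ k × suc k ≤ M
minority-bound {m} {M} {k} m<M m+M≡d = m≤k , +-cancelˡ-≤ k (suc k) M (begin
    k + suc k  ≡⟨ solve (k ∷ []) ⟩
    suc (2 * k) ≡⟨ m+M≡d ⟨
    m + M      ≤⟨ +-monoˡ-≤ M m≤k ⟩
    k + M      ∎)
  where
  open ≤-Reasoning
  m≤k : m ≤ k
  m≤k = *-cancelˡ-≤ 2 (s≤s⁻¹ (begin-strict
    2 * m      ≡⟨ cong (m +_) (+-identityʳ m) ⟩
    m + m      <⟨ +-monoʳ-< m m<M ⟩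
    m + M      ≡⟨ m+M≡d ⟩
    suc (2 * k) ∎))

minority-charge : ∀ {m M k} r → m < M → m + M ≡ suc (2 * k) → m * (suc k * r) ≤ M * (k * r)
minority-charge {m} {M} {k} r m<M m+M≡d with minority-bound {k = k} m<M m+M≡d
... | m≤k , k<M = begin
  m * (suc k * r)  ≡⟨ *-assoc m (suc k) r ⟨
  m * suc k * r    ≤⟨ *-monoˡ-≤ r (*-monoˡ-≤ (suc k) m≤k) ⟩
  k * suc k * r    ≡⟨ cong (_* r) (*-comm k (suc k)) ⟩
  suc k * k * r    ≤⟨ *-monoˡ-≤ r (*-monoˡ-≤ k k<M) ⟩
  M * k * r        ≡⟨ *-assoc M k r ⟩
  M * (k * r)      ∎
  where open ≤-Reasoning

majority-arc-balance : ∀ u∈V⁺ v∈V⁺ →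
  ind (u∈V⁺ ∧ not v∈V⁺) * 0 + (ind u∈V⁺ * 1 + ind (not v∈V⁺) * 1)
    ≤ ind (u∈V⁺ ∧ not v∈V⁺) * 2 + (ind (not u∈V⁺) * 1 + ind v∈V⁺ * 1)
majority-arc-balance true  true  = ≤-refl
majority-arc-balance true  false = ≤-refl
majority-arc-balance false true  = z≤n
majority-arc-balance false false = ≤-refl

cut-arc-balance : ∀ k u∈V⁺ u∈S v∈V⁺ v∈S →
  ind (u∈S ∧ not v∈S) * suc (2 * k)
    + (ind u∈V⁺ * (k * (k + ind (u∈V⁺ xor u∈S)))
       + ind (not v∈V⁺) * (k * (k + ind (v∈V⁺ xor v∈S))))
  ≤ ind (u∈V⁺ ∧ not v∈V⁺) * (k * k + suc k * suc k)
    + (ind (not u∈V⁺) * (suc k * (k + ind (u∈V⁺ xor u∈S)))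
       + ind v∈V⁺ * (suc k * (k + ind (v∈V⁺ xor v∈S))))
cut-arc-balance k true  true  true  true  = ≤-slack k (solve (k ∷ []))
cut-arc-balance k true  true  true  false = ≤-slack 0 (solve (k ∷ []))
cut-arc-balance k true  true  false true  = ≤-slack (suc k) (solve (k ∷ []))
cut-arc-balance k true  true  false false = ≤-slack 0 (solve (k ∷ []))
cut-arc-balance k true  false true  true  = ≤-slack 0 (solve (k ∷ []))
cut-arc-balance k true  false true  false = ≤-slack (suc k) (solve (k ∷ []))
cut-arc-balance k true  false false true  = ≤-slack 1 (solve (k ∷ []))
cut-arc-balance k true  false false false = ≤-slack (suc k) (solve (k ∷ []))
cut-arc-balance k false true  true  true  = z≤n
cut-arc-balance k false true  true  false = ≤-slack (k * suc (2 * k) + suc k) (solve (k ∷ []))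
cut-arc-balance k false true  false true  = ≤-slack (suc k) (solve (k ∷ []))
cut-arc-balance k false true  false false = ≤-slack 0 (solve (k ∷ []))
cut-arc-balance k false false true  true  = z≤n
cut-arc-balance k false false true  false = z≤n
cut-arc-balance k false false false true  = ≤-slack 0 (solve (k ∷ []))
cut-arc-balance k false false false false = ≤-slack k (solve (k ∷ []))

module OddRegular {n : ℕ} (G : Digraph n) (oriented : IsOriented G)
                  (k : ℕ) (regular : IsRegular G (suc (2 * k))) where

  degree-sum : ∀ w → outdeg G w + indeg G w ≡ suc (2 * k)
  degree-sum w = trans (outdeg+indeg≡undeg G oriented w) (regular w)

  majority-side : ∀ w →
    (inV⁺ G w ≡ true × inV⁻ G w ≡ false × indeg G w < outdeg G w) ⊎
    (inV⁺ G w ≡ false × inV⁻ G w ≡ true × outdeg G w < indeg G w)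
  majority-side w with <-cmp (indeg G w) (outdeg G w)
  ... | tri< i<o _ _ = inj₁ (<ᵇ-true i<o , <ᵇ-false (<⇒≤ i<o) , i<o)
  ... | tri> _ _ o<i = inj₂ (<ᵇ-false (<⇒≤ o<i) , <ᵇ-true o<i , o<i)
  ... | tri≈ _ i≡o _ = contradiction
    (trans (cong (outdeg G w +_) (trans (+-identityʳ _) (sym i≡o))) (degree-sum w))
    (even≢odd (outdeg G w) k)

  inV⁻≡not-inV⁺ : ∀ w → inV⁻ G w ≡ not (inV⁺ G w)
  inV⁻≡not-inV⁺ w with majority-side w
  ... | inj₁ (plus , minus , _) rewrite plus = minus
  ... | inj₂ (plus , minus , _) rewrite plus = minus

  minor major : Fin n → ℕ
  minor w = if inV⁺ G w then indeg G w else outdeg G w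
  major w = if inV⁺ G w then outdeg G w else indeg G w

  minor<major : ∀ w → minor w < major w
  minor<major w with majority-side w
  ... | inj₁ (plus , _ , i<o) rewrite plus = i<o
  ... | inj₂ (plus , _ , o<i) rewrite plus = o<i

  minor+major : ∀ w → minor w + major w ≡ suc (2 * k)
  minor+major w with majority-side w
  ... | inj₁ (plus , _ , _) rewrite plus = trans (+-comm (indeg G w) (outdeg G w)) (degree-sum w)
  ... | inj₂ (plus , _ , _) rewrite plus = degree-sum w

  e : ℕ
  e = arcsBetween G (inV⁺ G) (inV⁻ G)

  e≡arcs-from-V⁺ : arcsBetween G (inV⁺ G) (not ∘ inV⁺ G) ≡ e
  e≡arcs-from-V⁺ = arcsBetween-congʳ G (inV⁺ G) (sym ∘ inV⁻≡not-inV⁺)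

  n≤2e : n ≤ 2 * e
  n≤2e = subst₂ _≤_ (trans (+-identityʳ (n * 1)) (*-identityʳ n)) (cong (2 *_) e≡arcs-from-V⁺)
    (majority-discharge G (inV⁺ G) (λ _ → 1) (λ _ → 1)
      1 0 (inV⁺ G) (not ∘ inV⁺ G) 2 (inV⁺ G) (not ∘ inV⁺ G)
      (λ u v _ → majority-arc-balance (inV⁺ G u) (inV⁺ G v))
      (λ w → subst₂ _≤_ (cong suc (sym (*-identityʳ (minor w)))) (sym (*-identityʳ (major w)))
                        (minor<major w)))

  dicut-bound : ∀ S → suc (2 * k) * dicut G S ≤ (k * k + suc k * suc k) * e
  dicut-bound S =
    subst₂ _≤_ (cong (_+ suc (2 * k) * dicut G S) (*-zeroʳ n))
               (cong ((k * k + suc k * suc k) *_) e≡arcs-from-V⁺)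
    (majority-discharge G (inV⁺ G) (λ w → k * r w) (λ w → suc k * r w)
      0 (suc (2 * k)) S (not ∘ S) (k * k + suc k * suc k) (inV⁺ G) (not ∘ inV⁺ G)
      (λ u v _ → cut-arc-balance k (inV⁺ G u) (S u) (inV⁺ G v) (S v))
      (λ w → minority-charge {k = k} (r w) (minor<major w) (minor+major w)))
    where
    r : Fin n → ℕ
    r w = k + ind (inV⁺ G w xor S w)

theorem9 : (n d : ℕ) (G : Digraph n) → IsOriented G → IsRegular G d → Odd d →
    (n ≤ 2 * arcsBetween G (inV⁺ G) (inV⁻ G)) ×
    (2 * d * maxdicut G ≤ (d * d + 1) * arcsBetween G (inV⁺ G) (inV⁻ G))
theorem9 n d G oriented regular (k , refl) =
  n≤2e , subst₂ _≤_ (sym (*-assoc 2 d (maxdicut G))) (rescale k e)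
                    (*-monoʳ-≤ 2 (maxdicut-lub G {c = d} dicut-bound))
  where
  open OddRegular G oriented k regular
  rescale : ∀ k x → 2 * ((k * k + suc k * suc k) * x) ≡ (suc (2 * k) * suc (2 * k) + 1) * x
  rescale = solve-∀
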